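{- Let $k\geq 1$ and let $(G,L)$ be a reduced instance of $\textsc{LHom}(C_{2k+1})$. Let $u\in V(G)$ with $L(u)=\{i\}$ and let $v\in V(G)$ with $\mathrm{dist}_G(u,v)=d$. Then $L(v)\subseteq\{\,i+j \;:\; j\in\{ -d,-d+2,\ldots,d-2,d\}\,\}$ (arithmetic modulo $2k+1$); that is, for $d$ even $L(v)\subseteq\{i-d,i-d+2,\ldots,i-2,i,i+2,\ldots,i+d\}$ and for $d$ odd $L(v)\subseteq\{i-d,i-d+2,\ldots,i-1,i+1,\ldots,i+d\}$. In particular, if $d\leq k-1$, then $L(v)$ is an independent set in $C_{2k+1}$.
   Context: All graphs are finite and simple. $C_{2k+1}$ has vertex set $\{0,1,\ldots,2k\}$ with $i$ adjacent to $i\pm1$, arithmetic modulo $2k+1$. An instance of $\textsc{LHom}(H)$ is a graph $G$ with lists $L:V(G)\to 2^{V(H)}$ (asking for $\varphi:V(G)\to V(H)$, $\varphi(v)\in L(v)$, preserving edges). Identifying vertices means replacing them by a single vertex adjacent to the union of their neighbourhoods. An instance is reduced if applying any of the following rules neither returns NO nor changes the instance: (R1) If $H=C_{2k+1}$ and $G$ contains an odd cycle of length at most $2k-1$, return NO. (R2) If $H=C_{2k+1}$ and $G$ contains two $(2k+1)$-cycles with consecutive vertices $c_0,\ldots,c_{2k}$ and $c'_0,\ldots,c'_{2k}$ with $c_0=c'_0$ and $c_i=c'_j$ for some $i,j\neq0$: if $i=j$ identify $c_\ell$ with $c'_\ell$ for all $\ell$; if $i=-j$ identify $c_\ell$ with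 $c'_{ -\ell}$ for all $\ell$; otherwise return NO. (R3) For every edge $uv$, if $x\in L(u)$ has $N_H(x)\cap L(v)=\emptyset$, remove $x$ from $L(u)$. (R4) If some list is empty, return NO. (R5) For $v\in V(G)$, if distinct $x,y\in L(v)$ satisfy $N_H(x)\cap L(w)\subseteq N_H(y)\cap L(w)$ for all $w\in N_G(v)$, remove $x$ from $L(v)$. (R6) If distinct $u,v$ have $L(u)=L(v)=\{x\}$: if $uv\in E(G)$ return NO, else identify $u$ and $v$. -}

module Defs where

open import Data.Nat using (ℕ; zero; suc; _+_; _*_; _≤_; _<_; _∸_; _%_)
open import Data.Fin using (Fin; toℕ) renaming (zero to fzero)
open import Data.Fin.Subset using (Subset; _∈_; ⁅_⁆)
open import Data.Product using (Σ; ∃; ∃-syntax; _×_; _,_)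
open import Data.Sum using (_⊎_)
open import Data.Empty using (⊥)
open import Relation.Nullary using (¬_)
open import Relation.Binary.PropositionalEquality using (_≡_; _≢_)
open import Function.Definitions using (Injective)

record Graph : Set₁ where
  field
    n      : ℕ
    _~_    : Fin n → Fin n → Set
    ~-sym  : ∀ {u v} → u ~ v → v ~ u
    ~-irr  : ∀ {u} → ¬ (u ~ u)
open Graph public

SuccMod : (m : ℕ) → Fin m → Fin m → Set
SuccMod m a b = (toℕ b ≡ suc (toℕ a)) ⊎ ((suc (toℕ a) ≡ m) × (toℕ b ≡ 0))

CAdj : (m : ℕ) → Fin m → Fin m → Set
CAdj m x y = SuccMod m x y ⊎ SuccMod m y x

IsCycle : (G : Graph) (m : ℕ) → (Fin m → Fin (n G)) → Set
IsCycle G m c =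
  (3 ≤ m) × Injective _≡_ _≡_ c ×
  (∀ (a b : Fin m) → SuccMod m a b → _~_ G (c a) (c b))

data Walk (G : Graph) : Fin (n G) → Fin (n G) → ℕ → Set where
  here : ∀ {u} → Walk G u u 0
  step : ∀ {u w v ℓ} → _~_ G u w → Walk G w v ℓ → Walk G u v (suc ℓ)

Dist : (G : Graph) → Fin (n G) → Fin (n G) → ℕ → Set
Dist G u v d = Walk G u v d × (∀ e → e < d → ¬ Walk G u v e)

Odd : ℕ → Set
Odd m = ∃[ t ] m ≡ suc (2 * t)

Lists : (G : Graph) (k : ℕ) → Set
Lists G k = Fin (n G) → Subset (suc (2 * k))

-- Reducedness: each rule (R1)–(R6) neither returns NO nor changes the instance.
module _ (k : ℕ) (G : Graph) (L : Lists G k) where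
  private
    m = suc (2 * k)
    V = Fin (n G)
    _≈_ = _~_ G

  R1-stable : Set
  R1-stable = ∀ ℓ → Odd ℓ → ℓ ≤ 2 * k ∸ 1 → (c : Fin ℓ → V) → ¬ IsCycle G ℓ c

  R2-stable : Set
  R2-stable = ∀ (c c' : Fin m → V) → IsCycle G m c → IsCycle G m c' →
    c fzero ≡ c' fzero → ∀ (i j : Fin m) → toℕ i ≢ 0 → toℕ j ≢ 0 → c i ≡ c' j →
      (toℕ i ≡ toℕ j × (∀ ℓ → c ℓ ≡ c' ℓ))
    ⊎ (toℕ i + toℕ j ≡ m ×
        (∀ ℓ ℓ' → (toℕ ℓ + toℕ ℓ' ≡ 0 ⊎ toℕ ℓ + toℕ ℓ' ≡ m) → c ℓ ≡ c' ℓ'))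

  R3-stable : Set
  R3-stable = ∀ u v → u ≈ v → ∀ x → x ∈ L u → ∃[ y ] (CAdj m x y × y ∈ L v)

  R4-stable : Set
  R4-stable = ∀ v → ∃[ x ] x ∈ L v

  R5-stable : Set
  R5-stable = ∀ v x y → x ≢ y → x ∈ L v → y ∈ L v →
    ¬ (∀ w → v ≈ w → ∀ z → CAdj m x z → z ∈ L w → CAdj m y z)

  R6-stable : Set
  R6-stable = ∀ u v x → L u ≡ ⁅ x ⁆ → L v ≡ ⁅ x ⁆ → u ≡ v

  Reduced : Set
  Reduced = R1-stable × R2-stable × R3-stable × R4-stable × R5-stable × R6-stable

{-# OPTIONS --safe #-}
-- Only arc consistency (R3) and some u–v walk of length d are needed. Walking back
-- from v, R3 traces each colour x ∈ L(v) to a colour of L(u) = {i}, which yields a walk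
-- of length d from i to x in C_{2k+1}, hence x ≡ i + d − 2t for some t ≤ d. Two
-- adjacent colours x and x + 1 of L(v) would then give 2t ≡ 2t' + 1 (mod 2k+1), which
-- is impossible by parity when both sides are below 2k + 1, i.e. when d ≤ k − 1.
module Submission where

open import Defs
open import Data.Nat using (ℕ; suc; _+_; _*_; _≤_; _<_; _∸_; _%_; NonZero; s≤s; z≤n; z<s)
open import Data.Nat.Properties
  using (+-suc; <⇒≤; ≤-<-trans; <-trans; n<1+n; m≤n⇒m≤1+n; *-monoʳ-≤; *-monoʳ-<;
         ∸-monoʳ-<; m+[n∸m]≡n; even≢odd)
open import Data.Nat.DivMod using (%-distribˡ-+; [m+n]%n≡m%n; m<n⇒m%n≡m)
open import Data.Nat.Tactic.RingSolver using (solve-∀)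
open import Data.Fin using (Fin; toℕ)
open import Data.Fin.Properties using (toℕ<n)
open import Data.Fin.Subset using (_∈_; ⁅_⁆)
open import Data.Fin.Subset.Properties using (x∈⁅y⁆⇒x≡y)
open import Data.Product using (∃-syntax; _×_; _,_)
open import Data.Sum using (inj₁; inj₂)
open import Relation.Nullary using (¬_)
open import Relation.Binary.PropositionalEquality
  using (_≡_; refl; sym; trans; cong; subst; module ≡-Reasoning)

module _ (m : ℕ) .{{_ : NonZero m}} where
  open ≡-Reasoning

  infix 4 _≡_[mod]

  _≡_[mod] : ℕ → ℕ → Set
  a ≡ b [mod] = a % m ≡ b % m

  +-congʳ-mod : ∀ {a b} c → a ≡ b [mod] → a + c ≡ b + c [mod]
  +-congʳ-mod {a} {b} c a≡b = begin
    (a + c) % m           ≡⟨ %-distribˡ-+ a c m ⟩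
    (a % m + c % m) % m   ≡⟨ cong (λ r → (r + c % m) % m) a≡b ⟩
    (b % m + c % m) % m   ≡⟨ %-distribˡ-+ b c m ⟨
    (b + c) % m           ∎

  +-cancelˡ-mod : ∀ {x a b} → x ≤ m → x + a ≡ x + b [mod] → a ≡ b [mod]
  +-cancelˡ-mod {x} {a} {b} x≤m x+a≡x+b = begin
    a % m                    ≡⟨ [m+n]%n≡m%n a m ⟨
    (a + m) % m              ≡⟨ cong (_% m) (complement a) ⟨
    (x + a + (m ∸ x)) % m    ≡⟨ +-congʳ-mod (m ∸ x) x+a≡x+b ⟩
    (x + b + (m ∸ x)) % m    ≡⟨ cong (_% m) (complement b) ⟩
    (b + m) % m              ≡⟨ [m+n]%n≡m%n b m ⟩
    b % m                    ∎
    where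
    complement : ∀ c → x + c + (m ∸ x) ≡ c + m
    complement c = begin
      x + c + (m ∸ x)    ≡⟨ rearrange x c (m ∸ x) ⟩
      c + (x + (m ∸ x))  ≡⟨ cong (c +_) (m+[n∸m]≡n x≤m) ⟩
      c + m              ∎
      where
      rearrange : ∀ p q r → p + q + r ≡ q + (p + r)
      rearrange = solve-∀

  <-mod-injective : ∀ {a b} → a < m → b < m → a ≡ b [mod] → a ≡ b
  <-mod-injective a<m b<m a≡b =
    trans (sym (m<n⇒m%n≡m a<m)) (trans a≡b (m<n⇒m%n≡m b<m))

  SuccMod⇒suc≡[mod] : ∀ {a b : Fin m} → SuccMod m a b → suc (toℕ a) ≡ toℕ b [mod]
  SuccMod⇒suc≡[mod] (inj₁ b≡1+a) = cong (_% m) (sym b≡1+a)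
  SuccMod⇒suc≡[mod] {a} {b} (inj₂ (1+a≡m , b≡0)) = begin
    suc (toℕ a) % m  ≡⟨ cong (_% m) 1+a≡m ⟩
    m % m            ≡⟨ [m+n]%n≡m%n 0 m ⟩
    0 % m            ≡⟨ cong (_% m) b≡0 ⟨
    toℕ b % m        ∎

  -- A walk of length ℓ in C_m from y with f forward and t backward steps ends at
  -- y + f − t = y + ℓ − 2t.
  Reachable : ℕ → Fin m → Fin m → Set
  Reachable ℓ y x = ∃[ t ] (t ≤ ℓ × toℕ x + 2 * t ≡ toℕ y + ℓ [mod])

  reachable-refl : ∀ {x} → Reachable 0 x x
  reachable-refl = 0 , z≤n , refl

  reachable-step : ∀ {ℓ x y z} → CAdj m y z → Reachable ℓ y x → Reachable (suc ℓ) z x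
  reachable-step {ℓ} {x} {y} {z} (inj₁ y→z) (t , t≤ℓ , x+2t≡y+ℓ) =
    suc t , s≤s t≤ℓ , (begin
      (toℕ x + 2 * suc t) % m      ≡⟨ cong (_% m) (two-more (toℕ x) t) ⟩
      (toℕ x + 2 * t + 2) % m      ≡⟨ +-congʳ-mod 2 x+2t≡y+ℓ ⟩
      (toℕ y + ℓ + 2) % m          ≡⟨ cong (_% m) (shift (toℕ y) ℓ) ⟩
      (suc (toℕ y) + suc ℓ) % m    ≡⟨ +-congʳ-mod (suc ℓ) (SuccMod⇒suc≡[mod] y→z) ⟩
      (toℕ z + suc ℓ) % m          ∎)
    where
    two-more : ∀ p q → p + 2 * suc q ≡ p + 2 * q + 2
    two-more = solve-∀
    shift : ∀ p q → p + q + 2 ≡ suc p + suc q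
    shift = solve-∀
  reachable-step {ℓ} {x} {y} {z} (inj₂ z→y) (t , t≤ℓ , x+2t≡y+ℓ) =
    t , m≤n⇒m≤1+n t≤ℓ , (begin
      (toℕ x + 2 * t) % m      ≡⟨ x+2t≡y+ℓ ⟩
      (toℕ y + ℓ) % m          ≡⟨ +-congʳ-mod ℓ (SuccMod⇒suc≡[mod] z→y) ⟨
      (suc (toℕ z) + ℓ) % m    ≡⟨ cong (_% m) (+-suc (toℕ z) ℓ) ⟨
      (toℕ z + suc ℓ) % m      ∎)

  reachable-nonadjacent : ∀ {ℓ i x y} → suc (2 * ℓ) < m →
    Reachable ℓ i x → Reachable ℓ i y → ¬ SuccMod m x y
  reachable-nonadjacent {ℓ} {i} {x} {y} bound (t , t≤ℓ , x+2t≡i+ℓ) (t' , t'≤ℓ , y+2t'≡i+ℓ) x→y =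
    even≢odd t t' (<-mod-injective 2t<m 1+2t'<m (+-cancelˡ-mod (<⇒≤ (toℕ<n x)) x+2t≡x+1+2t'))
    where
    2t<m : 2 * t < m
    2t<m = ≤-<-trans (*-monoʳ-≤ 2 t≤ℓ) (<-trans (n<1+n _) bound)
    1+2t'<m : suc (2 * t') < m
    1+2t'<m = ≤-<-trans (s≤s (*-monoʳ-≤ 2 t'≤ℓ)) bound
    x+2t≡x+1+2t' : toℕ x + 2 * t ≡ toℕ x + suc (2 * t') [mod]
    x+2t≡x+1+2t' = begin
      (toℕ x + 2 * t) % m          ≡⟨ x+2t≡i+ℓ ⟩
      (toℕ i + ℓ) % m              ≡⟨ y+2t'≡i+ℓ ⟨
      (toℕ y + 2 * t') % m         ≡⟨ +-congʳ-mod (2 * t') (SuccMod⇒suc≡[mod] x→y) ⟨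
      (suc (toℕ x) + 2 * t') % m   ≡⟨ cong (_% m) (+-suc (toℕ x) (2 * t')) ⟨
      (toℕ x + suc (2 * t')) % m   ∎

  reachable-independent : ∀ {ℓ i x y} → suc (2 * ℓ) < m →
    Reachable ℓ i x → Reachable ℓ i y → ¬ CAdj m x y
  reachable-independent bound i⇝x i⇝y (inj₁ x→y) = reachable-nonadjacent bound i⇝x i⇝y x→y
  reachable-independent bound i⇝x i⇝y (inj₂ y→x) = reachable-nonadjacent bound i⇝y i⇝x y→x

module _ {k : ℕ} {G : Graph} {L : Lists G k} (arc-consistent : R3-stable k G L) where

  walk-lifts-to-cycle : ∀ {a b ℓ x} → Walk G a b ℓ → x ∈ L b →
    ∃[ y ] (y ∈ L a × Reachable (suc (2 * k)) ℓ y x)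
  walk-lifts-to-cycle {x = x} here x∈Lb = x , x∈Lb , reachable-refl _ {x}
  walk-lifts-to-cycle {x = x} (step {u = a} {w = w} a~w w⇝b) x∈Lb with walk-lifts-to-cycle w⇝b x∈Lb
  ... | y , y∈Lw , y⇝x with arc-consistent w a (~-sym G a~w) y y∈Lw
  ... | z , y~z , z∈La = z , z∈La , reachable-step _ {x = x} y~z y⇝x

lemma3 : (k : ℕ) → 1 ≤ k → (G : Graph) → (L : Lists G k) → Reduced k G L →
    (u v : Fin (n G)) (i : Fin (suc (2 * k))) (d : ℕ) →
    L u ≡ ⁅ i ⁆ → Dist G u v d →
    (∀ x → x ∈ L v →
      ∃[ t ] (t ≤ d × (toℕ x + 2 * t) % suc (2 * k) ≡ (toℕ i + d) % suc (2 * k)))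
    × (d ≤ k ∸ 1 → ∀ x y → x ∈ L v → y ∈ L v → ¬ CAdj (suc (2 * k)) x y)
lemma3 k 1≤k G L (_ , _ , arc-consistent , _) u v i d Lu≡⁅i⁆ (u⇝v , _) =
  reachable-from-i , independent
  where
  reachable-from-i : ∀ x → x ∈ L v → Reachable (suc (2 * k)) d i x
  reachable-from-i x x∈Lv with walk-lifts-to-cycle {k} arc-consistent u⇝v x∈Lv
  ... | y , y∈Lu , y⇝x with refl ← x∈⁅y⁆⇒x≡y i (subst (y ∈_) Lu≡⁅i⁆ y∈Lu) = y⇝x

  independent : d ≤ k ∸ 1 → ∀ x y → x ∈ L v → y ∈ L v → ¬ CAdj (suc (2 * k)) x y
  independent d≤k∸1 x y x∈Lv y∈Lv =
    reachable-independent _ {i = i} {x} {y} (s≤s (*-monoʳ-< 2 d<k)) (reachable-from-i x x∈Lv) (reachable-from-i y y∈Lv)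
    where
    d<k : d < k
    d<k = ≤-<-trans d≤k∸1 (∸-monoʳ-< z<s 1≤k)
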